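{- Every instance of the rules $R_S$ and $R_C$ is one-step tableau sound with respect to the AMCDES: for every set $X$ and every valuation $\tau:\mathrm{PV}\to\mathcal P(X)$, if $[\![\Phi]\!]\tau\neq\emptyset$ for the premiss $\Phi$ of the rule instance, then $[\![\Theta_i]\!]\tau\neq\emptyset$ for some conclusion $\Theta_i$ of it.
   Context: Fix a finite linearly ordered set $N$ of agents and for each agent $j$ a set $M_j$ of explicit strategies; $M_D=\prod_{j\in D}M_j$ for a coalition $D\subseteq N$; $\overline C=N\setminus C$; $[k]=\{1,\dots,k\}$, $[k]_C=\prod_{j\in C}[k_j]$; $m|_D$ is restriction, and $n\sqsubseteq m$ means $n=m|_{\mathrm{Ag}(n)}$ where $\mathrm{Ag}(n)$ is the coalition on which $n$ is defined. For a set $O\subseteq M_D$ write $\mathrm{Ag}(O)=D$. For joint explicit moves $n,m$ write $n=_\sqcap m$ if $n|_{\mathrm{Ag}(n)\cap\mathrm{Ag}(m)}=m|_{\mathrm{Ag}(n)\cap\mathrm{Ag}(m)}$; $()$ is the empty joint move. For a set $X$, let $G X$ be the set of triples $((k_j)_{j\in N},f,\iota)$ with $k_j\ge1$, $f:[k]_N\to X$, $\iota_j:M_j\to[k_j]$; for $m\in M_D$, $\iota(m)$ has components $\iota_j(m_j)$, and $\iota[O]=\{\iota(m)\mid m\in O\}$. Modalities are $[C,O]$ and $\langle C,O\rangle$ with $C\subseteq N$, $O\subseteq M_D$ for a coalition $D$ disjoint from $C$, and $|O|=1$ whenever $C\cup\mathrm{Ag}(O)=N$; a single joint move $r$ stands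 for $\{r\}$. For $Y\subseteq X$: $[\![ [C,O] ]\!]_X(Y)=\{((k_j),f,\iota)\mid\exists m_C\in[k]_C\,\forall m\in[k]_N.\ (m_C\sqsubseteq m\wedge m|_{\mathrm{Ag}(O)}\in\iota[O])\Rightarrow f(m)\in Y\}$, $[\![\langle C,O\rangle]\!]_X(Y)=\{((k_j),f,\iota)\mid\forall m_C\in[k]_C\,\exists m\in[k]_N.\ m_C\sqsubseteq m\wedge m|_{\mathrm{Ag}(O)}\in\iota[O]\wedge f(m)\in Y\}$. Fix a set $\mathrm{PV}$ of propositional variables. A one-step rule $\Phi/\Theta_1\mid\dots\mid\Theta_n$ has a premiss $\Phi$, a finite set of modal atoms $\heartsuit a$ ($\heartsuit$ a modality, $a\in\mathrm{PV}$, each variable occurring at most once), and conclusions $\Theta_i$, finite sets of variables from $\Phi$. For $\tau:\mathrm{PV}\to\mathcal P(X)$: $[\![\Theta]\!]\tau=\bigcap_{a\in\Theta}\tau(a)$ ($=X$ if $\Theta=\emptyset$) and $[\![\Phi]\!]\tau=\bigcap_{\heartsuit a\in\Phi}[\![\heartsuit]\!]_X(\tau(a))\subseteq GX$. Rule $R_C$: its instances are given by pairwise distinct variables $a_1,\dots,a_\alpha,b,c_1,\dots,c_\beta$, modalities $[D_j,P_{G_j}]$ ($\mathrm{Ag}(P_{G_j})=G_j$), $\langle E,Q_K\rangle$ ($\mathrm{Ag}(Q_K)=K$), $\langle C_j,r_{H_j}\rangle$ with $r_{H_j}\in M_{H_j}$ a single joint explicit move, and sets $I_q\subseteq\{1,\dots,\alpha\}$,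 $J_q\subseteq\{1,\dots,\beta\}$ for each $q\in Q_K$; premiss $\{[D_1,P_{G_1}]a_1,\dots,[D_\alpha,P_{G_\alpha}]a_\alpha,\langle E,Q_K\rangle b,\langle C_1,r_{H_1}\rangle c_1,\dots,\langle C_\beta,r_{H_\beta}\rangle c_\beta\}$, and one conclusion $\{a_j\mid j\in I_q\}\cup\{b\}\cup\{c_j\mid j\in J_q\}$ for each $q\in Q_K$; subject to, with $L=\bigcup_jG_j\cup\bigcup_jH_j$: (1) $D_j\cap D_k=\emptyset$ for $j\neq k$; (2) $C_j\cup H_j=N$ for all $j$; (3) $\bigcup_jD_j\cap L=\emptyset$; (4) $\bigcup_jD_j\subseteq E$; (5) $E\cup K\supseteq L$; (6) $r_{H_j}=_\sqcap q$ for all $q\in Q_K$, $j\in J_q$; (7) there is a joint explicit move $l\in M_{E\cap L}$ such that $r_{H_j}=_\sqcap l$ for all $q\in Q_K$, $j\in J_q$, and for each $q\in Q_K$ and $j\in I_q$ there is $p\in P_{G_j}$ with $p=_\sqcap q$ and $p=_\sqcap l$. Rule $R_S$: instances have premiss $\{[D_1,P_{G_1}]a_1,\dots,[D_\alpha,P_{G_\alpha}]a_\alpha,\langle C_1,r_{H_1}\rangle c_1,\dots,\langle C_\beta,r_{H_\beta}\rangle c_\beta\}$ (pairwise distinct variables) and single conclusion $\{a_1,\dots,a_\alpha,c_1,\dots,c_\beta\}$, subject to conditions (1), (2), (3) above and: there is $l\in M_L$ with $r_{H_j}=_\sqcap l$ for all $j\le\beta$, and for each $j\le\alpha$ some $p\in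 P_{G_j}$ with $p=_\sqcap l$. -}

module Defs where

open import Data.Nat using (ℕ; zero; suc; _≤_)
open import Data.Fin using (Fin; zero; suc)
open import Data.Fin.Subset using (Subset; _∈_; _∩_; _∪_; ⊤; ⊥; _⊆_; Empty)
open import Data.Product using (Σ; Σ-syntax; _×_; _,_)
open import Data.Unit using () renaming (⊤ to Unit)
open import Relation.Binary.PropositionalEquality using (_≡_; _≢_)
open import Function using (_∘_)

-- Agents: N = Fin n (finite, linearly ordered).  Coalitions: Subset n.

-- Dependent tuples: the product ∏_{j : Fin n} A j, encoded so that
-- pointwise-equal tuples are propositionally equal (no funext needed).
DVec : ∀ {n} → (Fin n → Set) → Set
DVec {zero} A = Unit
DVec {suc n} A = A zero × DVec (A ∘ suc)

dlookup : ∀ {n} {A : Fin n → Set} → DVec A → (j : Fin n) → A j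
dlookup {suc n} (x , xs) zero = x
dlookup {suc n} (x , xs) (suc j) = dlookup xs j

⋃ᶠ : ∀ {n α} → (Fin α → Subset n) → Subset n
⋃ᶠ {α = zero} F = ⊥
⋃ᶠ {α = suc α} F = F zero ∪ ⋃ᶠ (F ∘ suc)

module _ {n : ℕ} where

  -- joint moves over a coalition D (elements of ∏_{j∈D} A j)
  JM : (Fin n → Set) → Subset n → Set
  JM A D = (j : Fin n) → j ∈ D → A j

  _=⊓_ : ∀ {A : Fin n → Set} {D E : Subset n} → JM A D → JM A E → Set
  x =⊓ y = ∀ j p q → x j p ≡ y j q

  _≈_ : ∀ {A : Fin n → Set} {D : Subset n} → JM A D → JM A D → Set
  x ≈ y = ∀ j p → x j p ≡ y j p

  Singleton : ∀ {M : Fin n → Set} {D : Subset n} → (JM M D → Set) → Set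
  Singleton {M} {D} O = Σ[ r ∈ JM M D ] (O r × (∀ o → O o → o ≈ r))

  single : ∀ {M : Fin n → Set} {D : Subset n} → JM M D → (JM M D → Set)
  single r o = o ≈ r

  WFMod : ∀ {M : Fin n → Set} {D : Subset n} → Subset n → (JM M D → Set) → Set
  WFMod {D = D} C O = Empty (C ∩ D) × (C ∪ D ≡ ⊤ → Singleton O)

  record GX (M : Fin n → Set) (X : Set) : Set where
    field
      k     : Fin n → ℕ
      k-pos : ∀ j → 1 ≤ k j
      f     : DVec (λ j → Fin (k j)) → X
      ι     : (j : Fin n) → M j → Fin (k j)

  module _ {M : Fin n → Set} {X : Set} (g : GX M X) where
    open GX g

    Moves : Set
    Moves = DVec (λ j → Fin (k j))

    _⊑_ : ∀ {C : Subset n} → JM (λ j → Fin (k j)) C → Moves → Set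
    mC ⊑ m = ∀ j p → mC j p ≡ dlookup m j

    InImg : ∀ {D : Subset n} → (JM M D → Set) → Moves → Set
    InImg {D} O m = Σ[ o ∈ JM M D ] (O o × (∀ j p → dlookup m j ≡ ι j (o j p)))

  Box : ∀ {M : Fin n → Set} {X : Set} {D : Subset n} →
        Subset n → (JM M D → Set) → (X → Set) → GX M X → Set
  Box C O Y g = Σ[ mC ∈ JM (λ j → Fin (GX.k g j)) C ]
                  (∀ m → _⊑_ g mC m → InImg g O m → Y (GX.f g m))

  Dia : ∀ {M : Fin n → Set} {X : Set} {D : Subset n} →
        Subset n → (JM M D → Set) → (X → Set) → GX M X → Set
  Dia C O Y g = ∀ (mC : JM (λ j → Fin (GX.k g j)) C) →
                  Σ[ m ∈ Moves g ] (_⊑_ g mC m × InImg g O m × Y (GX.f g m))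

  Lset : ∀ {α β} → (Fin α → Subset n) → (Fin β → Subset n) → Subset n
  Lset G H = ⋃ᶠ G ∪ ⋃ᶠ H

  record RSInst (M : Fin n → Set) (PV : Set) : Set₁ where
    field
      α β : ℕ
      a : Fin α → PV
      c : Fin β → PV
      a-inj : ∀ i j → a i ≡ a j → i ≡ j
      c-inj : ∀ i j → c i ≡ c j → i ≡ j
      a≢c : ∀ i j → a i ≢ c j
      D G : Fin α → Subset n
      P : (i : Fin α) → JM M (G i) → Set
      wfP : ∀ i → WFMod (D i) (P i)
      C H : Fin β → Subset n
      r : (j : Fin β) → JM M (H j)
      wfr : ∀ j → WFMod (C j) (single (r j))
      cond1 : ∀ i j → i ≢ j → Empty (D i ∩ D j)
      cond2 : ∀ j → C j ∪ H j ≡ ⊤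
      cond3 : Empty (⋃ᶠ D ∩ Lset G H)
      condl : Σ[ l ∈ JM M (Lset G H) ]
                ((∀ j → r j =⊓ l) ×
                 (∀ i → Σ[ p ∈ JM M (G i) ] (P i p × p =⊓ l)))

  module _ {M : Fin n → Set} {PV : Set} (R : RSInst M PV) where
    open RSInst R

    PremS : {X : Set} → (PV → X → Set) → GX M X → Set
    PremS τ g = (∀ i → Box (D i) (P i) (τ (a i)) g) ×
                (∀ j → Dia (C j) (single (r j)) (τ (c j)) g)

    ConclS : {X : Set} → (PV → X → Set) → X → Set
    ConclS τ x = (∀ i → τ (a i) x) × (∀ j → τ (c j) x)

    SoundS : Set₁
    SoundS = ∀ (X : Set) (τ : PV → X → Set) →
             Σ (GX M X) (PremS τ) → Σ X (ConclS τ)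

  -- Instances of rule R_C   (Q_K = {Q 0, …, Q (κ-1)}, listed without repetition)
  record RCInst (M : Fin n → Set) (PV : Set) : Set₁ where
    field
      α β κ : ℕ
      a : Fin α → PV
      b : PV
      c : Fin β → PV
      a-inj : ∀ i j → a i ≡ a j → i ≡ j
      c-inj : ∀ i j → c i ≡ c j → i ≡ j
      a≢c : ∀ i j → a i ≢ c j
      b≢a : ∀ i → b ≢ a i
      b≢c : ∀ j → b ≢ c j
      D G : Fin α → Subset n
      P : (i : Fin α) → JM M (G i) → Set
      wfP : ∀ i → WFMod (D i) (P i)
      E K : Subset n
      Q : Fin κ → JM M K
      Q-inj : ∀ q q' → Q q ≈ Q q' → q ≡ q'
      wfQ : WFMod E (λ o → Σ[ q ∈ Fin κ ] (o ≈ Q q))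
      C H : Fin β → Subset n
      r : (j : Fin β) → JM M (H j)
      wfr : ∀ j → WFMod (C j) (single (r j))
      I : Fin κ → Subset α
      J : Fin κ → Subset β
      cond1 : ∀ i j → i ≢ j → Empty (D i ∩ D j)
      cond2 : ∀ j → C j ∪ H j ≡ ⊤
      cond3 : Empty (⋃ᶠ D ∩ Lset G H)
      cond4 : ⋃ᶠ D ⊆ E
      cond5 : Lset G H ⊆ E ∪ K
      cond6 : ∀ q j → j ∈ J q → r j =⊓ Q q
      cond7 : Σ[ l ∈ JM M (E ∩ Lset G H) ]
                ((∀ q j → j ∈ J q → r j =⊓ l) ×
                 (∀ q i → i ∈ I q →
                    Σ[ p ∈ JM M (G i) ] (P i p × p =⊓ Q q × p =⊓ l)))

  module _ {M : Fin n → Set} {PV : Set} (R : RCInst M PV) where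
    open RCInst R

    PremC : {X : Set} → (PV → X → Set) → GX M X → Set
    PremC τ g = (∀ i → Box (D i) (P i) (τ (a i)) g) ×
                Dia E (λ o → Σ[ q ∈ Fin κ ] (o ≈ Q q)) (τ b) g ×
                (∀ j → Dia (C j) (single (r j)) (τ (c j)) g)

    ConclC : {X : Set} → (PV → X → Set) → Fin κ → X → Set
    ConclC τ q x = (∀ i → i ∈ I q → τ (a i) x) × τ b x ×
                   (∀ j → j ∈ J q → τ (c j) x)

    SoundC : Set₁
    SoundC = ∀ (X : Set) (τ : PV → X → Set) →
             Σ (GX M X) (PremC τ) → Σ[ q ∈ Fin κ ] Σ X (ConclC τ q)

{-# OPTIONS --safe #-}
-- For both rules, the agents in the box coalitions D_i play the strategies that witness the boxes,
-- and every agent of L = ⋃ G_i ∪ ⋃ H_j plays the image of the common move l; the two sets of agents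
-- are disjoint by condition (3).  Such a profile meets every box, and since C_j ∪ H_j = N a diamond
-- ⟨C_j, r_j⟩ has only one admissible outcome against it, namely the profile itself.  For R_C the
-- profile is first restricted to E and handed to the opponent of ⟨E, Q_K⟩; the answer picks some q,
-- and agents outside E but in L then play ι(q), which condition (7) makes compatible with every
-- box and diamond of the conclusion for q.
module Submission where

open import Defs
open import Data.Nat using (ℕ)
open import Data.Fin using (Fin; zero; suc; fromℕ<; _≟_)
open import Data.Fin.Properties using (any?)
open import Data.Fin.Subset using (Subset; _∈_; _∩_; _∪_; _⊆_; ⊤; Empty)
open import Data.Fin.Subset.Properties
  using (_∈?_; ∈⊤; x∈p∩q⁺; p∩q⊆p; p∩q⊆q; x∈p∪q⁻; p⊆p∪q; q⊆p∪q)
open import Data.Vec.Properties.WithK using ([]=-irrelevant)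
open import Data.Product using (Σ-syntax; _×_; _,_; proj₁; proj₂)
open import Data.Sum using (_⊎_; inj₁; inj₂)
open import Data.Unit using (tt)
open import Data.Empty using (⊥-elim)
open import Relation.Nullary using (yes; no)
open import Relation.Binary.PropositionalEquality using (_≡_; _≢_; refl; sym; trans; cong; cong₂; subst)
open import Function using (_∘_)

⊆-⋃ᶠ : ∀ {n α} (F : Fin α → Subset n) (i : Fin α) → F i ⊆ ⋃ᶠ F
⊆-⋃ᶠ F zero    = p⊆p∪q _
⊆-⋃ᶠ F (suc i) = q⊆p∪q _ _ ∘ ⊆-⋃ᶠ (F ∘ suc) i

Empty-∩-antitoneʳ : ∀ {n} {p q r : Subset n} → q ⊆ r → Empty (p ∩ r) → Empty (p ∩ q)
Empty-∩-antitoneʳ {p = p} {q} q⊆r empty (x , x∈p∩q) =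
  empty (x , x∈p∩q⁺ (p∩q⊆p p q x∈p∩q , q⊆r (p∩q⊆q p q x∈p∩q)))

∈-∪-⊤ : ∀ {n} (p q : Subset n) → p ∪ q ≡ ⊤ → ∀ x → x ∈ p ⊎ x ∈ q
∈-∪-⊤ p q p∪q≡⊤ x = x∈p∪q⁻ p q (subst (x ∈_) (sym p∪q≡⊤) ∈⊤)

dtabulate : ∀ {n} {A : Fin n → Set} → ((j : Fin n) → A j) → DVec A
dtabulate {ℕ.zero}  h = tt
dtabulate {ℕ.suc n} h = h zero , dtabulate (h ∘ suc)

dlookup-dtabulate : ∀ {n} {A : Fin n → Set} (h : (j : Fin n) → A j) (j : Fin n) →
                    dlookup (dtabulate {A = A} h) j ≡ h j
dlookup-dtabulate h zero    = refl
dlookup-dtabulate h (suc j) = dlookup-dtabulate (h ∘ suc) j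

DVec-ext : ∀ {n} {A : Fin n → Set} (u v : DVec A) → (∀ j → dlookup u j ≡ dlookup v j) → u ≡ v
DVec-ext {ℕ.zero}  tt      tt      _   = refl
DVec-ext {ℕ.suc n} (x , u) (y , v) u≗v = cong₂ _,_ (u≗v zero) (DVec-ext u v (u≗v ∘ suc))

module _ {n : ℕ} {M : Fin n → Set} {X : Set} (g : GX M X) where
  open GX g

  Plays : ∀ {A : Subset n} → Moves g → JM M A → Set
  Plays m s = ∀ j p → dlookup m j ≡ ι j (s j p)

  plays-restrict : ∀ {A B : Subset n} {m : Moves g} {s : JM M A} {t : JM M B} →
                   B ⊆ A → t =⊓ s → Plays m s → Plays m t
  plays-restrict B⊆A t=s m▷s j p = trans (m▷s j (B⊆A p)) (cong (ι j) (sym (t=s j p (B⊆A p))))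

  plays-glue : ∀ {A A′ B : Subset n} {m : Moves g} {s : JM M A} {s′ : JM M A′} {t : JM M B} →
               (∀ j → j ∈ B → j ∈ A ⊎ j ∈ A′) → t =⊓ s → t =⊓ s′ →
               Plays m s → Plays m s′ → Plays m t
  plays-glue cover t=s t=s′ m▷s m▷s′ j p with cover j p
  ... | inj₁ a  = trans (m▷s j a) (cong (ι j) (sym (t=s j p a)))
  ... | inj₂ a′ = trans (m▷s′ j a′) (cong (ι j) (sym (t=s′ j p a′)))

  -- The opponent may only vary agents of C, and must also play ι(r) on H; as C ∪ H = N the
  -- outcome m is forced.
  Dia-single-covering : ∀ {C H : Subset n} {r : JM M H} {Y : X → Set} →
                        C ∪ H ≡ ⊤ → Dia C (single r) Y g → ∀ m → Plays m r → Y (f m)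
  Dia-single-covering {C} {H} {Y = Y} C∪H≡⊤ dia m m▷r with dia (λ j _ → dlookup m j)
  ... | m′ , m⊑m′ , (o , o≈r , m′▷o) , y = subst Y (cong f (DVec-ext m′ m m′≗m)) y
    where
    m′≗m : ∀ j → dlookup m′ j ≡ dlookup m j
    m′≗m j with ∈-∪-⊤ C H C∪H≡⊤ j
    ... | inj₁ c = sym (m⊑m′ j c)
    ... | inj₂ h = trans (m′▷o j h) (trans (cong (ι j) (o≈r j h)) (sym (m▷r j h)))

  extending-profile :
    ∀ {α} (D : Fin α → Subset n) (mD : ∀ i → JM (λ j → Fin (k j)) (D i)) →
    (∀ i i′ → i ≢ i′ → Empty (D i ∩ D i′)) →
    ∀ {L} (l : JM M L) → Empty (⋃ᶠ D ∩ L) →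
    Σ[ m ∈ Moves g ] ((∀ i → _⊑_ g (mD i) m) × Plays m l)
  extending-profile D mD D-disjoint {L} l D∩L-empty =
    dtabulate h ,
    (λ i j p → sym (trans (dlookup-dtabulate h j) (h-on-D i j p))) ,
    (λ j p → trans (dlookup-dtabulate h j) (h-on-L j p))
    where
    h : (j : Fin n) → Fin (k j)
    h j with any? (λ i → j ∈? D i)
    ... | yes (i , p) = mD i j p
    ... | no _ with j ∈? L
    ...   | yes p = ι j (l j p)
    ...   | no _  = fromℕ< (k-pos j)

    h-on-D : ∀ i j (p : j ∈ D i) → h j ≡ mD i j p
    h-on-D i j p with any? (λ i → j ∈? D i)
    ... | no ∉D = ⊥-elim (∉D (i , p))
    ... | yes (i′ , p′) with i ≟ i′
    ...   | yes refl = cong (mD i j) ([]=-irrelevant p′ p)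
    ...   | no i≢i′  = ⊥-elim (D-disjoint i i′ i≢i′ (j , x∈p∩q⁺ (p , p′)))

    h-on-L : ∀ j (p : j ∈ L) → h j ≡ ι j (l j p)
    h-on-L j p with any? (λ i → j ∈? D i)
    ... | yes (i , d) = ⊥-elim (D∩L-empty (j , x∈p∩q⁺ (⊆-⋃ᶠ D i d , p)))
    ... | no _ with j ∈? L
    ...   | yes p′ = cong (ι j ∘ l j) ([]=-irrelevant p′ p)
    ...   | no ∉L  = ⊥-elim (∉L p)

module _ {n : ℕ} {M : Fin n → Set} {PV : Set} where

  soundS : (R : RSInst M PV) → SoundS R
  soundS R X τ (g , boxes , dias)
    with RSInst.condl R
  ... | l , r=l , a-witness
    with extending-profile g (RSInst.D R) (proj₁ ∘ boxes) (RSInst.cond1 R) l (RSInst.cond3 R)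
  ... | m , m⊒boxes , m▷l = GX.f g m , a-holds , c-holds
    where
    open RSInst R

    a-holds : ∀ i → τ (a i) (GX.f g m)
    a-holds i with a-witness i
    ... | p , Pp , p=l =
      proj₂ (boxes i) m (m⊒boxes i) (p , Pp , plays-restrict g (p⊆p∪q _ ∘ ⊆-⋃ᶠ G i) p=l m▷l)

    c-holds : ∀ j → τ (c j) (GX.f g m)
    c-holds j = Dia-single-covering g {Y = τ (c j)} (cond2 j) (dias j) m
                  (plays-restrict g (q⊆p∪q _ _ ∘ ⊆-⋃ᶠ H j) (r=l j) m▷l)

  soundC : (R : RCInst M PV) → SoundC R
  soundC R X τ (g , boxes , diaE , dias)
    with RCInst.cond7 R
  ... | l , r=l , a-witness
    with extending-profile g (RCInst.D R) (proj₁ ∘ boxes) (RCInst.cond1 R) l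
           (Empty-∩-antitoneʳ (p∩q⊆q (RCInst.E R) _) (RCInst.cond3 R))
  ... | m₀ , m₀⊒boxes , m₀▷l
    with diaE (λ j _ → dlookup m₀ j)
  ... | m , m₀⊑m , (o , (q , o≈Q) , m▷o) , bm = q , f m , a-holds , bm , c-holds
    where
    open RCInst R
    open GX g using (f; ι)

    m▷l : Plays g m l
    m▷l j p = trans (sym (m₀⊑m j (p∩q⊆p E _ p))) (m₀▷l j p)

    m▷Q : Plays g m (Q q)
    m▷Q j p = trans (m▷o j p) (cong (ι j) (o≈Q j p))

    covered : ∀ {B} → B ⊆ Lset G H → ∀ j → j ∈ B → j ∈ E ∩ Lset G H ⊎ j ∈ K
    covered B⊆L j p with x∈p∪q⁻ E K (cond5 (B⊆L p))
    ... | inj₁ e = inj₁ (x∈p∩q⁺ (e , B⊆L p))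
    ... | inj₂ k = inj₂ k

    a-holds : ∀ i → i ∈ I q → τ (a i) (f m)
    a-holds i i∈I with a-witness q i i∈I
    ... | p , Pp , p=Q , p=l =
      proj₂ (boxes i) m (λ j d → trans (m₀⊒boxes i j d) (m₀⊑m j (cond4 (⊆-⋃ᶠ D i d))))
        (p , Pp , plays-glue g (covered (p⊆p∪q _ ∘ ⊆-⋃ᶠ G i)) p=l p=Q m▷l m▷Q)

    c-holds : ∀ j → j ∈ J q → τ (c j) (f m)
    c-holds j j∈J = Dia-single-covering g {Y = τ (c j)} (cond2 j) (dias j) m
      (plays-glue g (covered (q⊆p∪q _ _ ∘ ⊆-⋃ᶠ H j)) (r=l q j j∈J) (cond6 q j j∈J) m▷l m▷Q)

lemma21 : ∀ {n : ℕ} (M : Fin n → Set) (PV : Set) →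
          (∀ (R : RSInst M PV) → SoundS R) × (∀ (R : RCInst M PV) → SoundC R)
lemma21 M PV = soundS , soundC
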